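{- Let $k$ be a positive integer, $X$ a finite set, and $\sigma\in\mathrm{SIM}(X)$ with disjoint path and cycle decomposition $\sigma=\sigma_1\sigma_2\cdots\sigma_n$. Then $\alpha\in\mathrm{SIM}(X)$ is a $k$th root of $\sigma$ if and only if $\alpha$ is a product of distinct, disjoint $k$-interlacings of groups of the paths and/or cycles $\sigma_1,\dots,\sigma_n$, excluding none of them; that is, if and only if there is a set partition $\{P_1,\dots,P_m\}$ of $\{\sigma_1,\dots,\sigma_n\}$ such that $\alpha=\alpha_1\cdots\alpha_m$ where each $\alpha_j$ is a $k$-interlacing of the paths/cycles in $P_j$.
   Context: For a finite set $X$, $\mathrm{SIM}(X)$ is the symmetric inverse monoid: the set of all partial one-to-one maps from $X$ to itself, under composition. For distinct $a_1,\dots,a_\ell$, the path $[a_1a_2\cdots a_\ell]$ is the partial map sending $a_i\mapsto a_{i+1}$ for $i<\ell$ and undefined at $a_\ell$ (so $[a]$ is the nowhere-defined map on $\{a\}$); the cycle $(a_1\cdots a_\ell)$ sends $a_i\mapsto a_{i+1}$ for $i<\ell$ and $a_\ell\mapsto a_1$. Its length is $\ell$ and $a_1,\dots,a_\ell$ are its digits. Paths/cycles are disjoint if their digit sets are disjoint, and a product of disjoint paths/cycles is the partial map on the union of their digits agreeing with each one on its digits. Every element of $\mathrm{SIM}(X)$ is uniquely a product of disjoint paths and cycles whose digit sets partition $X$ (its disjoint path and cycle decomposition, length-one paths and cycles included). A $k$th root of $\sigma$ is $\alpha\in\mathrm{SIM}(X)$ with $\alpha^k=\sigma$. Given disjoint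 paths and/or cycles $\tau_1,\dots,\tau_r$ with union of digit sets $D$, a $k$-interlacing of them is a single path or single cycle $\beta$ whose set of digits is exactly $D$ and such that $\beta^k=\tau_1\tau_2\cdots\tau_r$. -}

module Defs where

open import Data.Nat using (ℕ; zero; suc)
open import Data.Fin using (Fin) renaming (_≟_ to _≟F_)
open import Data.Maybe using (Maybe; just; nothing; _>>=_)
open import Data.List using (List; []; _∷_; _++_; length; lookup; map; concat; allFin)
open import Data.List.Relation.Unary.Unique.Propositional using (Unique)
open import Data.List.Relation.Unary.All using (All)
open import Data.List.Relation.Binary.Pointwise using (Pointwise)
open import Data.List.Relation.Binary.Permutation.Propositional using (_↭_)
open import Data.List.Membership.Propositional using (_∈_)
open import Data.Bool using (Bool; true; false; if_then_else_)
open import Data.Product using (Σ; ∃; _×_; _,_)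
open import Data.Empty using (⊥)
open import Relation.Nullary using (does; ¬_)
open import Relation.Binary.PropositionalEquality using (_≡_)
open import Function.Bundles using (_⇔_)

PMap : ℕ → Set
PMap N = Fin N → Maybe (Fin N)

IsPartialInjective : {N : ℕ} → PMap N → Set
IsPartialInjective {N} f = ∀ (x y z : Fin N) → f x ≡ just z → f y ≡ just z → x ≡ y

_≐_ : {N : ℕ} → PMap N → PMap N → Set
f ≐ g = ∀ x → f x ≡ g x

-- composition (apply g first, then f) and identity
_∘ₚ_ : {N : ℕ} → PMap N → PMap N → PMap N
(f ∘ₚ g) x = g x >>= f

idₚ : {N : ℕ} → PMap N
idₚ x = just x

_^ₚ_ : {N : ℕ} → PMap N → ℕ → PMap N
f ^ₚ zero = idₚ
f ^ₚ suc k = f ∘ₚ (f ^ₚ k)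

data Kind : Set where
  path cycle : Kind

record PC (N : ℕ) : Set where
  constructor mkPC
  field
    kind   : Kind
    first  : Fin N
    rest   : List (Fin N)
    unique : Unique (first ∷ rest)

digits : {N : ℕ} → PC N → List (Fin N)
digits τ = PC.first τ ∷ PC.rest τ

-- successor of x in a list (first occurrence), nothing if x is last / absent
nextIn : {N : ℕ} → List (Fin N) → Fin N → Maybe (Fin N)
nextIn [] x = nothing
nextIn (a ∷ []) x = nothing
nextIn (a ∷ b ∷ l) x = if does (a ≟F x) then just b else nextIn (b ∷ l) x

⟦_⟧ : {N : ℕ} → PC N → PMap N
⟦ mkPC path a l _ ⟧ = nextIn (a ∷ l)
⟦ mkPC cycle a l _ ⟧ = nextIn ((a ∷ l) ++ (a ∷ []))

memb : {N : ℕ} → Fin N → List (Fin N) → Bool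
memb x [] = false
memb x (a ∷ l) = if does (a ≟F x) then true else memb x l

prodPC : {N : ℕ} → List (PC N) → PMap N
prodPC [] x = nothing
prodPC (τ ∷ τs) x = if memb x (digits τ) then ⟦ τ ⟧ x else prodPC τs x

record IsDecomposition {N : ℕ} (σ : PMap N) (σs : List (PC N)) : Set where
  field
    disjoint : ∀ (i j : Fin (length σs)) (x : Fin N) →
               x ∈ digits (lookup σs i) → x ∈ digits (lookup σs j) → i ≡ j
    covers   : ∀ (x : Fin N) → ∃ λ (i : Fin (length σs)) → x ∈ digits (lookup σs i)
    product  : σ ≐ prodPC σs

IsInterlacing : {N : ℕ} → ℕ → List (PC N) → PC N → Set
IsInterlacing {N} k τs β =
  (∀ (x : Fin N) → (x ∈ digits β) ⇔ (∃ λ (τ : PC N) → τ ∈ τs × x ∈ digits τ))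
  × ((⟦ β ⟧ ^ₚ k) ≐ prodPC τs)

data NonEmpty {A : Set} : List A → Set where
  nonEmpty : ∀ {a l} → NonEmpty (a ∷ l)

IsSetPartition : (n : ℕ) → List (List (Fin n)) → Set
IsSetPartition n blocks = All NonEmpty blocks × (concat blocks ↭ allFin n)

-- A product α of
-- k-interlacings βⱼ of the blocks of a set partition of the σᵢ is a k-th root of σ: the βⱼ
-- have disjoint digit sets (the blocks are disjoint), so α agrees with βⱼ on the digits of βⱼ,
-- a set closed under βⱼ, and there αᵏ = βⱼᵏ, the product of the block, which is σ.
-- Conversely, let αᵏ = σ with α a partial injection.  Decompose α into disjoint paths and
-- cycles γ (built point by point: each new step p ↦ α p either joins two paths or closes a
-- path into a cycle).  Each γ is closed under α, hence under σ, and since the γ partition X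
-- no σ-step enters γ either; as the digits of σᵢ form a σ-chain, each σᵢ lies in a single γ.
-- Grouping the σᵢ by the component containing their first digit gives a set partition, and
-- γ is a k-interlacing of its block because γᵏ = αᵏ = σ on the digits of γ.
module Submission where

open import Defs
open import Data.Nat using (ℕ; zero; suc; _≤_; s≤s; z≤n)
open import Data.Fin using (Fin) renaming (_≟_ to _≟F_)
open import Data.Maybe using (just; nothing; _>>=_)
open import Data.List using (List; []; _∷_; _++_; length; lookup; map; concat; allFin; filter; head; [_])
open import Data.List.Properties using (++-assoc; ++-identityʳ; ∷ʳ-injective; filter-accept; filter-reject)
open import Data.List.Relation.Binary.Permutation.Propositional using (_↭_; prep; ↭-refl; ↭-trans; ↭-sym; ↭-reflexive; ↭⇒↭ₛ)
open import Data.List.Relation.Binary.Permutation.Setoid.Properties using (Unique-resp-↭)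
open import Data.List.Relation.Binary.Permutation.Propositional.Properties using (++⁺ˡ; shift; ∈-resp-↭)
open import Data.List.Relation.Binary.Pointwise using (Pointwise; []; _∷_)
open import Data.List.Relation.Binary.Disjoint.Propositional using (Disjoint)
open import Data.List.Relation.Unary.Linked using (Linked; []; [-]; _∷_)
open import Data.List.Relation.Unary.Unique.Propositional using (Unique)
import Data.List.Relation.Unary.Unique.Propositional.Properties as Unique
open import Data.List.Relation.Unary.AllPairs as AllPairs using (AllPairs; []; _∷_)
import Data.List.Relation.Unary.AllPairs.Properties as AllPairsP
open import Data.List.Relation.Unary.All as All using (All; []; _∷_)
open import Data.List.Relation.Unary.All.Properties as AllP using (All¬⇒¬Any)
open import Data.List.Relation.Unary.Any as Any using (Any; here; there)
open import Data.List.Relation.Unary.Any.Properties using (lookup-index)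
open import Data.List.Membership.Propositional using (_∈_; _∉_; lose)
open import Data.List.Membership.Propositional.Properties using (∈-++⁺ˡ; ∈-++⁺ʳ; ∈-++⁻; ∈-filter⁺; ∈-filter⁻; ∈-map⁺; ∈-map⁻; ∈-allFin; ∈-lookup; ∈-concat⁺′; ∈-concat⁻′)
open import Data.Sum using (_⊎_; inj₁; inj₂)
open import Data.Bool using (true; false; if_then_else_)
open import Data.Product using (Σ; ∃; _×_; _,_; proj₁; proj₂)
open import Data.Empty using (⊥; ⊥-elim)
open import Function.Base using (_on_)
open import Function.Bundles using (Equivalence; mk⇔; _⇔_)
open import Relation.Unary using (Decidable)
open import Relation.Nullary using (does; ¬_; yes; no; Dec)
open import Relation.Nullary.Decidable using (¬?; _×-dec_)
open import Relation.Binary.PropositionalEquality using (_≡_; refl; sym; trans; cong; subst; _≢_; setoid; module ≡-Reasoning)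

module _ {A : Set} where

  unique-++⇒disjoint : ∀ (xs : List A) {ys} → Unique (xs ++ ys) → Disjoint xs ys
  unique-++⇒disjoint (a ∷ xs) (a∉ ∷ _) (here refl , v∈ys) = All.lookup a∉ (∈-++⁺ʳ xs v∈ys) refl
  unique-++⇒disjoint (a ∷ xs) (_ ∷ u) (there v∈xs , v∈ys) = unique-++⇒disjoint xs u (v∈xs , v∈ys)

  unique-++⇒unique-right : ∀ (xs : List A) {ys} → Unique (xs ++ ys) → Unique ys
  unique-++⇒unique-right [] u = u
  unique-++⇒unique-right (_ ∷ xs) (_ ∷ u) = unique-++⇒unique-right xs u

module _ {A B : Set} {R : A → B → Set} where

  pointwise-∈ˡ : ∀ {xs ys x} → Pointwise R xs ys → x ∈ xs → ∃ λ y → y ∈ ys × R x y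
  pointwise-∈ˡ (r ∷ _) (here refl) = _ , here refl , r
  pointwise-∈ˡ (_ ∷ rs) (there x∈xs) with pointwise-∈ˡ rs x∈xs
  ... | y , y∈ys , r = y , there y∈ys , r

  pointwise-∈ʳ : ∀ {xs ys y} → Pointwise R xs ys → y ∈ ys → ∃ λ x → x ∈ xs × R x y
  pointwise-∈ʳ (r ∷ _) (here refl) = _ , here refl , r
  pointwise-∈ʳ (_ ∷ rs) (there y∈ys) with pointwise-∈ʳ rs y∈ys
  ... | x , x∈xs , r = x , there x∈xs , r

  pointwise-image : ∀ (f : B → A) (ys : List B) → (∀ y → y ∈ ys → R (f y) y) →
                    Pointwise R (map f ys) ys
  pointwise-image f [] _ = []
  pointwise-image f (y ∷ ys) h = h y (here refl) ∷ pointwise-image f ys (λ z m → h z (there m))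

module _ {A : Set} {R : A → A → Set} {S : A → Set} (invariant : ∀ {u v} → R u v → S u ⇔ S v) where

  linked-spread : ∀ {xs} → Linked R xs → Any S xs → All S xs
  linked-spread [-] (here s) = s ∷ []
  linked-spread (r ∷ rs) (here s) = s ∷ linked-spread rs (here (Equivalence.to (invariant r) s))
  linked-spread (r ∷ rs) (there s) with linked-spread rs s
  ... | all@(s′ ∷ _) = Equivalence.from (invariant r) s′ ∷ all

module _ {A B : Set} (Q : B → A → Set) (Q? : ∀ b → Decidable (Q b)) where

  filterAll : List B → List A → List A
  filterAll bs xs = concat (map (λ b → filter (Q? b) xs) bs)

  Exclusive : A → B → B → Set
  Exclusive x b b′ = ¬ (Q b x × Q b′ x)

  private
    filterAll-reject : ∀ x xs bs → All (λ b → ¬ Q b x) bs → filterAll bs (x ∷ xs) ≡ filterAll bs xs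
    filterAll-reject x xs [] [] = refl
    filterAll-reject x xs (b ∷ bs) (¬q ∷ ¬qs)
      rewrite filter-reject (Q? b) {x} {xs} ¬q | filterAll-reject x xs bs ¬qs = refl

    filterAll-accept : ∀ x xs bs → Any (λ b → Q b x) bs → AllPairs (Exclusive x) bs →
                       filterAll bs (x ∷ xs) ↭ x ∷ filterAll bs xs
    filterAll-accept x xs (b ∷ bs) (here q) (excl ∷ _)
      rewrite filter-accept (Q? b) {x} {xs} q
            | filterAll-reject x xs bs (All.map (λ e q′ → e (q , q′)) excl) = ↭-refl
    filterAll-accept x xs (b ∷ bs) (there q) (excl ∷ excls)
      rewrite filter-reject (Q? b) {x} {xs} (λ qb → All¬⇒¬Any (All.map (λ e q′ → e (qb , q′)) excl) q) =
      ↭-trans (++⁺ˡ (filter (Q? b) xs) (filterAll-accept x xs bs q excls))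
              (shift x (filter (Q? b) xs) (filterAll bs xs))

    filterAll-[] : ∀ bs → filterAll bs [] ≡ []
    filterAll-[] [] = refl
    filterAll-[] (_ ∷ bs) = filterAll-[] bs

  filterAll-↭ : ∀ xs bs → (∀ x → x ∈ xs → Any (λ b → Q b x) bs × AllPairs (Exclusive x) bs) →
                filterAll bs xs ↭ xs
  filterAll-↭ [] bs _ = ↭-reflexive (filterAll-[] bs)
  filterAll-↭ (x ∷ xs) bs h =
    ↭-trans (filterAll-accept x xs bs (proj₁ (h x (here refl))) (proj₂ (h x (here refl))))
            (prep x (filterAll-↭ xs bs (λ y m → h y (there m))))

module _ {N : ℕ} where
  open import Data.List.Membership.DecPropositional (_≟F_ {N}) using (_∈?_)

  private
    Digits : Set
    Digits = List (Fin N)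

  nextIn-∷ : ∀ (a : Fin N) l x → nextIn (a ∷ l) x ≡ (if does (a ≟F x) then head l else nextIn l x)
  nextIn-∷ a [] x with does (a ≟F x)
  ... | true = refl
  ... | false = refl
  nextIn-∷ a (b ∷ l) x = refl

  nextIn-++-defined : ∀ (D e : Digits) x {w} → nextIn D x ≡ just w → nextIn (D ++ e) x ≡ just w
  nextIn-++-defined (d ∷ D) e x eq rewrite nextIn-∷ d D x | nextIn-∷ d (D ++ e) x with d ≟F x
  ... | yes _ = head-++ D eq
    where
    head-++ : ∀ l {w} → head l ≡ just w → head (l ++ e) ≡ just w
    head-++ (_ ∷ _) eq = eq
  ... | no _ = nextIn-++-defined D e x eq

  nextIn-skip : ∀ (D m : Digits) x → x ∉ D → nextIn (D ++ m) x ≡ nextIn m x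
  nextIn-skip [] m x _ = refl
  nextIn-skip (d ∷ D) m x x∉ rewrite nextIn-∷ d (D ++ m) x with d ≟F x
  ... | yes refl = ⊥-elim (x∉ (here refl))
  ... | no _ = nextIn-skip D m x (λ p → x∉ (there p))

  nextIn-at : ∀ (pre e : Digits) x b → x ∉ pre → nextIn (pre ++ x ∷ b ∷ e) x ≡ just b
  nextIn-at pre e x b x∉ = trans (nextIn-skip pre (x ∷ b ∷ e) x x∉) at-head
    where
    at-head : nextIn (x ∷ b ∷ e) x ≡ just b
    at-head with x ≟F x
    ... | yes _ = refl
    ... | no x≢x = ⊥-elim (x≢x refl)

  nextIn-value-∈ : ∀ (D : Digits) x {w} → nextIn D x ≡ just w → w ∈ D
  nextIn-value-∈ (d ∷ D) x eq rewrite nextIn-∷ d D x with d ≟F x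
  ... | yes _ = there (head-∈ D eq)
    where
    head-∈ : ∀ l {w} → head l ≡ just w → w ∈ l
    head-∈ (_ ∷ _) refl = here refl
  ... | no _ = there (nextIn-value-∈ D x eq)

  nextIn-arg-∈ : ∀ (D : Digits) x {w} → nextIn D x ≡ just w → x ∈ D
  nextIn-arg-∈ (d ∷ D) x eq rewrite nextIn-∷ d D x with d ≟F x
  ... | yes refl = here refl
  ... | no _ = there (nextIn-arg-∈ D x eq)

  nextIn-defined : ∀ (D : Digits) b e x → x ∈ D → ∃ λ w → nextIn (D ++ b ∷ e) x ≡ just w
  nextIn-defined (d ∷ D) b e x x∈ rewrite nextIn-∷ d (D ++ b ∷ e) x with d ≟F x
  ... | yes _ = head-defined D
    where
    head-defined : ∀ D → ∃ λ w → head (D ++ b ∷ e) ≡ just w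
    head-defined [] = b , refl
    head-defined (c ∷ _) = c , refl
  ... | no d≢x with x∈
  ... | here refl = ⊥-elim (d≢x refl)
  ... | there x∈D = nextIn-defined D b e x x∈D

  nextIn-undefined⇒last : ∀ (D : Digits) x → nextIn D x ≡ nothing → x ∈ D → ∃ λ l → D ≡ l ++ [ x ]
  nextIn-undefined⇒last (d ∷ D) x eq x∈ rewrite nextIn-∷ d D x with d ≟F x
  nextIn-undefined⇒last (d ∷ []) x eq x∈ | yes refl = [] , refl
  nextIn-undefined⇒last (d ∷ _ ∷ _) x () x∈ | yes refl
  ... | no d≢x with x∈
  ... | here refl = ⊥-elim (d≢x refl)
  ... | there x∈D with nextIn-undefined⇒last D x eq x∈D
  ... | l , D≡ = d ∷ l , cong (d ∷_) D≡

  nextIn-++-not-last : ∀ (D lp : Digits) p x e → D ≡ lp ++ [ p ] → x ∈ D → x ≢ p →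
                       nextIn (D ++ e) x ≡ nextIn D x
  nextIn-++-not-last D lp p x e D≡ x∈ x≢p with nextIn D x in eq
  ... | just w = nextIn-++-defined D e x eq
  ... | nothing with nextIn-undefined⇒last D x eq x∈
  ... | l , D≡′ = ⊥-elim (x≢p (sym (proj₂ (∷ʳ-injective lp l (trans (sym D≡) D≡′)))))

  nextIn-++-last : ∀ (D lp : Digits) p b e → Unique D → D ≡ lp ++ [ p ] →
                   nextIn (D ++ b ∷ e) p ≡ just b
  nextIn-++-last D lp p b e u D≡ =
    subst (λ M → nextIn (M ++ b ∷ e) p ≡ just b) (sym D≡)
      (subst (λ M → nextIn M p ≡ just b) (sym (++-assoc lp [ p ] (b ∷ e)))
        (nextIn-at lp e p b (λ p∈lp → unique-++⇒disjoint lp (subst Unique D≡ u) (p∈lp , here refl))))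

  nextIn-consecutive : ∀ (D pre post e : Digits) z y → Unique D → D ≡ pre ++ z ∷ y ∷ post →
                       nextIn (D ++ e) z ≡ just y
  nextIn-consecutive D pre post e z y u refl =
    subst (λ M → nextIn M z ≡ just y) (sym (++-assoc pre (z ∷ y ∷ post) e))
      (nextIn-at pre (post ++ e) z y (λ z∈pre → unique-++⇒disjoint pre u (z∈pre , here refl)))

  nextIn-linked : ∀ (pre D e : Digits) → Unique (pre ++ D) →
                  Linked (λ u v → nextIn (pre ++ D ++ e) u ≡ just v) D
  nextIn-linked pre [] e u = []
  nextIn-linked pre (a ∷ []) e u = [-]
  nextIn-linked pre (a ∷ b ∷ D) e u =
    nextIn-at pre (D ++ e) a b (λ a∈pre → unique-++⇒disjoint pre u (a∈pre , here refl)) ∷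
    subst (λ M → Linked (λ u v → nextIn M u ≡ just v) (b ∷ D)) (++-assoc pre [ a ] (b ∷ D ++ e))
      (nextIn-linked (pre ++ [ a ]) (b ∷ D) e (subst Unique (sym (++-assoc pre [ a ] (b ∷ D))) u))

  split-last : ∀ (a : Fin N) l → ∃ λ pre → ∃ λ z → a ∷ l ≡ pre ++ [ z ]
  split-last a [] = [] , a , refl
  split-last a (b ∷ l) with split-last b l
  ... | pre , z , e = a ∷ pre , z , cong (a ∷_) e

  split-at-predecessor : ∀ (a : Fin N) l y → y ∈ l →
                         ∃ λ pre → ∃ λ z → ∃ λ post → a ∷ l ≡ pre ++ z ∷ y ∷ post
  split-at-predecessor a (b ∷ l) y (here refl) = [] , a , l , refl
  split-at-predecessor a (b ∷ l) y (there y∈l) with split-at-predecessor b l y y∈l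
  ... | pre , z , post , e = a ∷ pre , z , post , cong (a ∷_) e

  pc-codomain : ∀ (γ : PC N) x {w} → ⟦ γ ⟧ x ≡ just w → w ∈ digits γ
  pc-codomain (mkPC path a r u) x eq = nextIn-value-∈ (a ∷ r) x eq
  pc-codomain (mkPC cycle a r u) x eq with ∈-++⁻ (a ∷ r) (nextIn-value-∈ ((a ∷ r) ++ [ a ]) x eq)
  ... | inj₁ w∈ = w∈
  ... | inj₂ (here refl) = here refl

  pc-domain : ∀ (γ : PC N) x {w} → ⟦ γ ⟧ x ≡ just w → x ∈ digits γ
  pc-domain (mkPC path a r u) x eq = nextIn-arg-∈ (a ∷ r) x eq
  pc-domain (mkPC cycle a r u) x eq with ∈-++⁻ (a ∷ r) (nextIn-arg-∈ ((a ∷ r) ++ [ a ]) x eq)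
  ... | inj₁ x∈ = x∈
  ... | inj₂ (here refl) = here refl

  pc-outside : ∀ (γ : PC N) x → x ∉ digits γ → ⟦ γ ⟧ x ≡ nothing
  pc-outside γ x x∉ with ⟦ γ ⟧ x in eq
  ... | nothing = refl
  ... | just _ = ⊥-elim (x∉ (pc-domain γ x eq))

  pc-linked : ∀ (γ : PC N) → Linked (λ u v → ⟦ γ ⟧ u ≡ just v) (digits γ)
  pc-linked (mkPC path a r u) =
    subst (λ M → Linked (λ u v → nextIn M u ≡ just v) (a ∷ r)) (++-identityʳ (a ∷ r))
      (nextIn-linked [] (a ∷ r) [] u)
  pc-linked (mkPC cycle a r u) = nextIn-linked [] (a ∷ r) [ a ] u

  data EndsAt : PC N → Fin N → Set where
    ends : ∀ {a r u} lp {x} → a ∷ r ≡ lp ++ [ x ] → EndsAt (mkPC path a r u) x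

  data StartsAt : PC N → Fin N → Set where
    starts : ∀ {a r u} → StartsAt (mkPC path a r u) a

  undefined⇒path-end : ∀ (γ : PC N) x → x ∈ digits γ → ⟦ γ ⟧ x ≡ nothing → EndsAt γ x
  undefined⇒path-end (mkPC path a r u) x x∈ eq with nextIn-undefined⇒last (a ∷ r) x eq x∈
  ... | lp , e = ends lp e
  undefined⇒path-end (mkPC cycle a r u) x x∈ eq with nextIn-defined (a ∷ r) a [] x x∈
  ... | _ , e with trans (sym eq) e
  ... | ()

  no-predecessor⇒path-start : ∀ (γ : PC N) y → y ∈ digits γ → (∀ z → ⟦ γ ⟧ z ≢ just y) → StartsAt γ y
  no-predecessor⇒path-start (mkPC path a r u) y (here refl) _ = starts
  no-predecessor⇒path-start (mkPC cycle a r u) y (here refl) no-pred with split-last a r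
  ... | pre , z , D≡ = ⊥-elim (no-pred z (nextIn-++-last (a ∷ r) pre z a [] u D≡))
  no-predecessor⇒path-start (mkPC kind a r u) y (there y∈r) no-pred with split-at-predecessor a r y y∈r
  ... | pre , z , post , D≡ = ⊥-elim (no-pred z (predecessor kind))
    where
    predecessor : ∀ kind → ⟦ mkPC kind a r u ⟧ z ≡ just y
    predecessor path = subst (λ M → nextIn M z ≡ just y) (++-identityʳ (a ∷ r))
                         (nextIn-consecutive (a ∷ r) pre post [] z y u D≡)
    predecessor cycle = nextIn-consecutive (a ∷ r) pre post [ a ] z y u D≡

  memb-true⇒∈ : ∀ x (l : Digits) → memb x l ≡ true → x ∈ l
  memb-true⇒∈ x (a ∷ l) eq with a ≟F x
  ... | yes refl = here refl
  ... | no _ = there (memb-true⇒∈ x l eq)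

  memb-false⇒∉ : ∀ x (l : Digits) → memb x l ≡ false → x ∉ l
  memb-false⇒∉ x (a ∷ l) eq x∈ with a ≟F x
  memb-false⇒∉ x (a ∷ l) () x∈ | yes _
  ... | no a≢x with x∈
  ... | here refl = a≢x refl
  ... | there x∈l = memb-false⇒∉ x l eq x∈l

  -- Members of τs sharing a digit coincide (repetitions of one path/cycle are allowed).
  NonOverlapping : List (PC N) → Set
  NonOverlapping τs = ∀ {τ τ′} → τ ∈ τs → τ′ ∈ τs → ∀ {x} → x ∈ digits τ → x ∈ digits τ′ → τ ≡ τ′

  pairwise-disjoint⇒non-overlapping : ∀ {τs} → AllPairs (Disjoint on digits) τs → NonOverlapping τs
  pairwise-disjoint⇒non-overlapping (_ ∷ _) (here refl) (here refl) _ _ = refl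
  pairwise-disjoint⇒non-overlapping (d ∷ _) (here refl) (there τ′∈) x∈ x∈′ = ⊥-elim (All.lookup d τ′∈ (x∈ , x∈′))
  pairwise-disjoint⇒non-overlapping (d ∷ _) (there τ∈) (here refl) x∈ x∈′ = ⊥-elim (All.lookup d τ∈ (x∈′ , x∈))
  pairwise-disjoint⇒non-overlapping (_ ∷ ds) (there τ∈) (there τ′∈) x∈ x∈′ =
    pairwise-disjoint⇒non-overlapping ds τ∈ τ′∈ x∈ x∈′

  prodPC-on : ∀ (τs : List (PC N)) → NonOverlapping τs → ∀ {τ} → τ ∈ τs → ∀ x → x ∈ digits τ →
              prodPC τs x ≡ ⟦ τ ⟧ x
  prodPC-on (τ′ ∷ τs) shared {τ} τ∈ x x∈ with memb x (digits τ′) in eq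
  ... | true = cong (λ t → ⟦ t ⟧ x) (shared (here refl) τ∈ (memb-true⇒∈ x (digits τ′) eq) x∈)
  ... | false with τ∈
  ... | here refl = ⊥-elim (memb-false⇒∉ x (digits τ′) eq x∈)
  ... | there τ∈τs = prodPC-on τs (λ m m′ → shared (there m) (there m′)) τ∈τs x x∈

  prodPC-off : ∀ (τs : List (PC N)) x → (∀ τ → τ ∈ τs → x ∉ digits τ) → prodPC τs x ≡ nothing
  prodPC-off [] x _ = refl
  prodPC-off (τ ∷ τs) x x∉ with memb x (digits τ) in eq
  ... | true = ⊥-elim (x∉ τ (here refl) (memb-true⇒∈ x (digits τ) eq))
  ... | false = prodPC-off τs x (λ τ′ m → x∉ τ′ (there m))

  ^ₚ-unfold : ∀ (f : PMap N) m x → (f ^ₚ suc m) x ≡ (f x >>= (f ^ₚ m))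
  ^ₚ-unfold f zero x with f x
  ... | nothing = refl
  ... | just _ = refl
  ^ₚ-unfold f (suc m) x rewrite ^ₚ-unfold f m x with f x
  ... | nothing = refl
  ... | just _ = refl

  pow-agree : ∀ (f g : PMap N) (D : Digits) → (∀ z → z ∈ D → f z ≡ g z) →
              (∀ z w → z ∈ D → f z ≡ just w → w ∈ D) →
              ∀ m z → z ∈ D → (f ^ₚ m) z ≡ (g ^ₚ m) z
  pow-agree f g D agree closed zero z z∈ = refl
  pow-agree f g D agree closed (suc m) z z∈
    rewrite ^ₚ-unfold f m z | ^ₚ-unfold g m z | sym (agree z z∈) with f z in eq
  ... | nothing = refl
  ... | just w = pow-agree f g D agree closed m w (closed z w z∈ eq)

  pow-closed : ∀ (f : PMap N) (D : Digits) → (∀ z w → z ∈ D → f z ≡ just w → w ∈ D) →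
               ∀ m z w → z ∈ D → (f ^ₚ m) z ≡ just w → w ∈ D
  pow-closed f D closed zero z w z∈ refl = z∈
  pow-closed f D closed (suc m) z w z∈ eq rewrite ^ₚ-unfold f m z with f z in e
  ... | just v = pow-closed f D closed m v w (closed z v z∈ e) eq

  pow-undefined : ∀ (f : PMap N) m x → f x ≡ nothing → (f ^ₚ suc m) x ≡ nothing
  pow-undefined f m x fx rewrite ^ₚ-unfold f m x | fx = refl

  record PCDecomposition (f : PMap N) (γs : List (PC N)) : Set where
    field
      disjoint : AllPairs (Disjoint on digits) γs
      covers   : ∀ x → ∃ λ γ → γ ∈ γs × x ∈ digits γ
      agrees   : ∀ {γ} → γ ∈ γs → ∀ x → x ∈ digits γ → ⟦ γ ⟧ x ≡ f x

  PCDecomposition-resp : ∀ {f g γs} → f ≐ g → PCDecomposition f γs → PCDecomposition g γs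
  PCDecomposition-resp f≐g D = record
    { disjoint = disjoint ; covers = covers ; agrees = λ γ∈ x x∈ → trans (agrees γ∈ x x∈) (f≐g x) }
    where open PCDecomposition D

  PCDecomposition-product : ∀ {f γs} → PCDecomposition f γs → f ≐ prodPC γs
  PCDecomposition-product {f} {γs} D x with PCDecomposition.covers D x
  ... | γ , γ∈ , x∈ =
    sym (trans (prodPC-on γs (pairwise-disjoint⇒non-overlapping disjoint) γ∈ x x∈) (agrees γ∈ x x∈))
    where open PCDecomposition D

  _↾_ : PMap N → Digits → PMap N
  (f ↾ qs) x = if does (x ∈? qs) then f x else nothing

  ↾-∈ : ∀ (f : PMap N) qs {x} → x ∈ qs → (f ↾ qs) x ≡ f x
  ↾-∈ f qs {x} x∈ with x ∈? qs
  ... | yes _ = refl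
  ... | no x∉ = ⊥-elim (x∉ x∈)

  ↾-∉ : ∀ (f : PMap N) qs {x} → x ∉ qs → (f ↾ qs) x ≡ nothing
  ↾-∉ f qs {x} x∉ with x ∈? qs
  ... | yes x∈ = ⊥-elim (x∉ x∈)
  ... | no _ = refl

  ↾-other : ∀ (f : PMap N) {p qs x} → x ≢ p → (f ↾ (p ∷ qs)) x ≡ (f ↾ qs) x
  ↾-other f {p} {qs} {x} x≢p = by-cases (x ∈? qs)
    where
    by-cases : Dec (x ∈ qs) → (f ↾ (p ∷ qs)) x ≡ (f ↾ qs) x
    by-cases (yes x∈) = trans (↾-∈ f (p ∷ qs) (there x∈)) (sym (↾-∈ f qs x∈))
    by-cases (no x∉) =
      trans (↾-∉ f (p ∷ qs) λ { (here x≡p) → x≢p x≡p ; (there x∈) → x∉ x∈ }) (sym (↾-∉ f qs x∉))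

  Touches : Fin N → Fin N → PC N → Set
  Touches p y γ = p ∈ digits γ ⊎ y ∈ digits γ

  Untouched : Fin N → Fin N → PC N → Set
  Untouched p y γ = p ∉ digits γ × y ∉ digits γ

  untouched? : ∀ p y → Decidable (Untouched p y)
  untouched? p y γ = ¬? (p ∈? digits γ) ×-dec ¬? (y ∈? digits γ)

  replace-touched : ∀ f qs {γs} → PCDecomposition (f ↾ qs) γs → ∀ p y (new : PC N) →
    (∀ x → x ∈ digits new → ∃ λ γ → γ ∈ γs × Touches p y γ × x ∈ digits γ) →
    (∀ {γ} → γ ∈ γs → Touches p y γ → ∀ x → x ∈ digits γ → x ∈ digits new) →
    (∀ x → x ∈ digits new → ⟦ new ⟧ x ≡ (f ↾ (p ∷ qs)) x) →
    PCDecomposition (f ↾ (p ∷ qs)) (new ∷ filter (untouched? p y) γs)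
  replace-touched f qs {γs} D p y new new⊆touched touched⊆new new-agrees = record
    { disjoint = All.tabulate new-disjoint ∷ AllPairsP.filter⁺ (untouched? p y) disjoint
    ; covers = covers′
    ; agrees = agrees′ }
    where
    open PCDecomposition D
    shared : NonOverlapping γs
    shared = pairwise-disjoint⇒non-overlapping disjoint
    kept : Decidable (Untouched p y)
    kept = untouched? p y

    new-disjoint : ∀ {γ} → γ ∈ filter kept γs → Disjoint (digits new) (digits γ)
    new-disjoint γ∈ (x∈new , x∈γ) with new⊆touched _ x∈new | ∈-filter⁻ kept {xs = γs} γ∈
    ... | γ₀ , γ₀∈ , touch , x∈γ₀ | γ∈γs , (p∉ , y∉) with shared γ∈γs γ₀∈ x∈γ x∈γ₀
    ... | refl with touch
    ... | inj₁ p∈ = p∉ p∈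
    ... | inj₂ y∈ = y∉ y∈

    covers′ : ∀ x → ∃ λ γ → γ ∈ new ∷ filter kept γs × x ∈ digits γ
    covers′ x with covers x
    ... | γ , γ∈ , x∈ with p ∈? digits γ | y ∈? digits γ
    ... | yes p∈ | _ = new , here refl , touched⊆new γ∈ (inj₁ p∈) x x∈
    ... | no _ | yes y∈ = new , here refl , touched⊆new γ∈ (inj₂ y∈) x x∈
    ... | no p∉ | no y∉ = γ , there (∈-filter⁺ kept γ∈ (p∉ , y∉)) , x∈

    agrees′ : ∀ {γ} → γ ∈ new ∷ filter kept γs → ∀ x → x ∈ digits γ → ⟦ γ ⟧ x ≡ (f ↾ (p ∷ qs)) x
    agrees′ (here refl) x x∈ = new-agrees x x∈
    agrees′ (there γ∈) x x∈ with ∈-filter⁻ kept {xs = γs} γ∈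
    ... | γ∈γs , (p∉ , _) =
      trans (agrees γ∈γs x x∈) (sym (↾-other f {p} {qs} λ { refl → p∉ x∈ }))

  ↾-∷-unchanged : ∀ (f : PMap N) {p qs} → f p ≡ (f ↾ qs) p → (f ↾ qs) ≐ (f ↾ (p ∷ qs))
  ↾-∷-unchanged f {p} {qs} at-p x = by-cases (x ≟F p)
    where
    by-cases : Dec (x ≡ p) → (f ↾ qs) x ≡ (f ↾ (p ∷ qs)) x
    by-cases (yes refl) = sym (trans (↾-∈ f (p ∷ qs) (here refl)) at-p)
    by-cases (no x≢p) = sym (↾-other f {p} {qs} x≢p)

  single : Fin N → PC N
  single x = mkPC path x [] ([] ∷ [])

  singletons : ∀ f → PCDecomposition (f ↾ []) (map single (allFin N))
  singletons f = record
    { disjoint = AllPairsP.map⁺ (AllPairs.map distinct-singletons (Unique.allFin⁺ N))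
    ; covers = λ x → single x , ∈-map⁺ single (∈-allFin x) , here refl
    ; agrees = λ γ∈ x _ → undefined γ∈ x }
    where
    distinct-singletons : ∀ {a b} → a ≢ b → Disjoint (a ∷ []) (b ∷ [])
    distinct-singletons a≢b (here refl , here refl) = a≢b refl
    undefined : ∀ {γ} → γ ∈ map single (allFin N) → ∀ x → ⟦ γ ⟧ x ≡ (f ↾ []) x
    undefined γ∈ x with ∈-map⁻ single γ∈
    ... | _ , _ , refl = refl

  -- Every partial injection α is a product of pairwise disjoint paths and cycles.  The points
  -- are processed one by one, keeping a decomposition of α ↾ qs for the processed points qs.
  module Decompose (α : PMap N) (α-inj : IsPartialInjective α) where

    -- Processing p with α p = y: p ends a path and y starts a path; these are linked by
    -- the new step p ↦ y, closing a cycle if they are the same path.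
    module Link {qs γs} (D : PCDecomposition (α ↾ qs) γs) {p y} (p↦y : α p ≡ just y) (p∉qs : p ∉ qs) where
      open PCDecomposition D

      same-component : ∀ {γ′ γ} → γ′ ∈ γs → γ ∈ γs → ∀ {v} → v ∈ digits γ′ → v ∈ digits γ →
                       ∀ {x} → x ∈ digits γ′ → x ∈ digits γ
      same-component γ′∈ γ∈ v∈′ v∈ =
        subst (λ g → _ ∈ digits g) (pairwise-disjoint⇒non-overlapping disjoint γ′∈ γ∈ v∈′ v∈)

      Extended : Set
      Extended = ∃ (PCDecomposition (α ↾ (p ∷ qs)))

      at-p : (α ↾ (p ∷ qs)) p ≡ just y
      at-p = trans (↾-∈ α (p ∷ qs) (here refl)) p↦y

      away-from-p : ∀ {γ} → γ ∈ γs → ∀ x → x ∈ digits γ → x ≢ p → ⟦ γ ⟧ x ≡ (α ↾ (p ∷ qs)) x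
      away-from-p γ∈ x x∈ x≢p = trans (agrees γ∈ x x∈) (sym (↾-other α {p} {qs} x≢p))

      agree-at : ∀ (g : PMap N) x → (x ≡ p → g x ≡ just y) → (x ≢ p → g x ≡ (α ↾ (p ∷ qs)) x) →
                 g x ≡ (α ↾ (p ∷ qs)) x
      agree-at g x at-p′ off-p = by-cases (x ≟F p)
        where
        by-cases : Dec (x ≡ p) → g x ≡ (α ↾ (p ∷ qs)) x
        by-cases (yes refl) = trans (at-p′ refl) (sym at-p)
        by-cases (no x≢p) = off-p x≢p

      -- y has no predecessor yet: it could only be p, by injectivity, and p is unprocessed.
      no-predecessor : ∀ {γ} → γ ∈ γs → ∀ z → ⟦ γ ⟧ z ≢ just y
      no-predecessor {γ} γ∈ z z↦y = by-cases (z ∈? qs)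
        where
        z↦′y : (α ↾ qs) z ≡ just y
        z↦′y = trans (sym (agrees γ∈ z (pc-domain γ z z↦y))) z↦y
        by-cases : Dec (z ∈ qs) → ⊥
        by-cases (yes z∈qs) =
          p∉qs (subst (_∈ qs) (α-inj z p y (trans (sym (↾-∈ α qs z∈qs)) z↦′y) p↦y) z∈qs)
        by-cases (no z∉qs) with trans (sym (↾-∉ α qs z∉qs)) z↦′y
        ... | ()

      -- p and y lie on the same path [y ⋯ p]: it becomes the cycle (y ⋯ p).
      close : ∀ {γ} → γ ∈ γs → p ∈ digits γ → EndsAt γ p → StartsAt γ y → Extended
      close {mkPC path a r u} γ∈ p∈ (ends lp D≡) starts =
        _ , replace-touched α qs D p a (mkPC cycle a r u) new⊆touched touched⊆new new-agrees
        where
        new⊆touched : ∀ x → x ∈ a ∷ r → ∃ λ γ → γ ∈ γs × Touches p a γ × x ∈ digits γ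
        new⊆touched x x∈ = _ , γ∈ , inj₁ p∈ , x∈
        touched⊆new : ∀ {γ′} → γ′ ∈ γs → Touches p a γ′ → ∀ x → x ∈ digits γ′ → x ∈ a ∷ r
        touched⊆new γ′∈ (inj₁ p∈′) x x∈ = same-component γ′∈ γ∈ p∈′ p∈ x∈
        touched⊆new γ′∈ (inj₂ a∈′) x x∈ = same-component γ′∈ γ∈ a∈′ (here refl) x∈
        new-agrees : ∀ x → x ∈ a ∷ r → nextIn ((a ∷ r) ++ [ a ]) x ≡ (α ↾ (p ∷ qs)) x
        new-agrees x x∈ =
          agree-at (nextIn ((a ∷ r) ++ [ a ])) x (λ { refl → nextIn-++-last (a ∷ r) lp x a [] u D≡ })
            λ x≢p → trans (nextIn-++-not-last (a ∷ r) lp p x [ a ] D≡ x∈ x≢p) (away-from-p γ∈ x x∈ x≢p)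

      -- p ends a path [⋯ p] and y starts another path [y ⋯]: they are joined to [⋯ p y ⋯].
      join : ∀ {γp γy} → γp ∈ γs → γy ∈ γs → p ∈ digits γp → EndsAt γp p → StartsAt γy y →
             y ∉ digits γp → Extended
      join {mkPC path a r u} {mkPC path _ ry uy} γp∈ γy∈ p∈ (ends lp D≡) starts y∉ =
        _ , replace-touched α qs D p y new new⊆touched touched⊆new new-agrees
        where
        apart : Disjoint (a ∷ r) (y ∷ ry)
        apart (v∈p , v∈y) = y∉ (same-component γy∈ γp∈ v∈y v∈p (here refl))
        new : PC N
        new = mkPC path a (r ++ y ∷ ry) (Unique.++⁺ u uy apart)
        new⊆touched : ∀ x → x ∈ digits new → ∃ λ γ → γ ∈ γs × Touches p y γ × x ∈ digits γ
        new⊆touched x x∈ with ∈-++⁻ (a ∷ r) x∈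
        ... | inj₁ x∈p = _ , γp∈ , inj₁ p∈ , x∈p
        ... | inj₂ x∈y = _ , γy∈ , inj₂ (here refl) , x∈y
        touched⊆new : ∀ {γ′} → γ′ ∈ γs → Touches p y γ′ → ∀ x → x ∈ digits γ′ → x ∈ digits new
        touched⊆new γ′∈ (inj₁ p∈′) x x∈ = ∈-++⁺ˡ (same-component γ′∈ γp∈ p∈′ p∈ x∈)
        touched⊆new γ′∈ (inj₂ y∈′) x x∈ = ∈-++⁺ʳ (a ∷ r) (same-component γ′∈ γy∈ y∈′ (here refl) x∈)
        new-agrees : ∀ x → x ∈ digits new → ⟦ new ⟧ x ≡ (α ↾ (p ∷ qs)) x
        new-agrees x x∈ with ∈-++⁻ (a ∷ r) x∈
        ... | inj₂ x∈y = trans (nextIn-skip (a ∷ r) (y ∷ ry) x (λ x∈p → apart (x∈p , x∈y)))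
                               (away-from-p γy∈ x x∈y λ { refl → apart (p∈ , x∈y) })
        ... | inj₁ x∈p =
          agree-at ⟦ new ⟧ x (λ { refl → nextIn-++-last (a ∷ r) lp x y ry u D≡ })
            λ x≢p → trans (nextIn-++-not-last (a ∷ r) lp p x (y ∷ ry) D≡ x∈p x≢p)
                          (away-from-p γp∈ x x∈p x≢p)

      -- The component of p is a path ending at p, as α ↾ qs is undefined at p ...
      ends-at-p : ∀ {γ} → γ ∈ γs → p ∈ digits γ → EndsAt γ p
      ends-at-p {γ} γ∈ p∈ = undefined⇒path-end γ p p∈ (trans (agrees γ∈ p p∈) (↾-∉ α qs p∉qs))

      starts-at-y : ∀ {γ} → γ ∈ γs → y ∈ digits γ → StartsAt γ y
      starts-at-y {γ} γ∈ y∈ = no-predecessor⇒path-start γ y y∈ (no-predecessor γ∈)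

      extended : Extended
      extended with covers p
      ... | γp , γp∈ , p∈ with y ∈? digits γp
      ... | yes y∈ = close γp∈ p∈ (ends-at-p γp∈ p∈) (starts-at-y γp∈ y∈)
      ... | no y∉ with covers y
      ... | γy , γy∈ , y∈ = join γp∈ γy∈ p∈ (ends-at-p γp∈ p∈) (starts-at-y γy∈ y∈) y∉

    extend : ∀ p qs {γs} → PCDecomposition (α ↾ qs) γs → ∃ (PCDecomposition (α ↾ (p ∷ qs)))
    extend p qs {γs} D with p ∈? qs
    ... | yes p∈qs = γs , PCDecomposition-resp (↾-∷-unchanged α {p} {qs} (sym (↾-∈ α qs p∈qs))) D
    ... | no p∉qs with α p in p↦
    ... | just y = Link.extended D p↦ p∉qs
    ... | nothing = γs , PCDecomposition-resp (↾-∷-unchanged α {p} {qs} (trans p↦ (sym (↾-∉ α qs p∉qs)))) D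

    decompose-prefix : ∀ qs → ∃ (PCDecomposition (α ↾ qs))
    decompose-prefix [] = _ , singletons α
    decompose-prefix (p ∷ qs) = extend p qs (proj₂ (decompose-prefix qs))

  decompose : ∀ (α : PMap N) → IsPartialInjective α → ∃ (PCDecomposition α)
  decompose α α-inj with Decompose.decompose-prefix α α-inj (allFin N)
  ... | γs , D = γs , PCDecomposition-resp (λ x → ↾-∈ α (allFin N) (∈-allFin x)) D

∈⇒NonEmpty : ∀ {A : Set} {x : A} {l} → x ∈ l → NonEmpty l
∈⇒NonEmpty (here _) = nonEmpty
∈⇒NonEmpty (there _) = nonEmpty

module _ {N : ℕ} {σ : PMap N} {σs : List (PC N)} (dec : IsDecomposition σ σs) where
  open IsDecomposition dec renaming (disjoint to σs-disjoint; covers to σs-cover; product to σ-product)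
  open import Data.List.Membership.DecPropositional (_≟F_ {N}) using (_∈?_)

  private
    n : ℕ
    n = length σs

  σs-non-overlapping : NonOverlapping σs
  σs-non-overlapping {τ} {τ′} τ∈ τ′∈ {x} x∈ x∈′ =
    trans (lookup-index τ∈) (trans (cong (lookup σs) same-index) (sym (lookup-index τ′∈)))
    where
    same-index : Any.index τ∈ ≡ Any.index τ′∈
    same-index = σs-disjoint (Any.index τ∈) (Any.index τ′∈) x
                   (subst (λ t → x ∈ digits t) (lookup-index τ∈) x∈)
                   (subst (λ t → x ∈ digits t) (lookup-index τ′∈) x∈′)

  selection-non-overlapping : ∀ (B : List (Fin n)) → NonOverlapping (map (lookup σs) B)
  selection-non-overlapping B τ∈ τ′∈ = σs-non-overlapping (selected τ∈) (selected τ′∈)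
    where
    selected : ∀ {τ} → τ ∈ map (lookup σs) B → τ ∈ σs
    selected τ∈ with ∈-map⁻ (lookup σs) τ∈
    ... | i , _ , refl = ∈-lookup i

  σ-on : ∀ {τ} → τ ∈ σs → ∀ x → x ∈ digits τ → σ x ≡ ⟦ τ ⟧ x
  σ-on τ∈ x x∈ = trans (σ-product x) (prodPC-on σs σs-non-overlapping τ∈ x x∈)

  Interlaces : ℕ → List (Fin n) → PC N → Set
  Interlaces k B β = IsInterlacing k (map (lookup σs) B) β

  InterlacingFactorisation : ℕ → PMap N → Set
  InterlacingFactorisation k α =
    Σ (List (List (Fin n))) λ blocks → IsSetPartition n blocks ×
      (Σ (List (PC N)) λ βs → Pointwise (Interlaces k) blocks βs × (α ≐ prodPC βs))

  interlacing-digit : ∀ k {B β} → Interlaces k B β → ∀ {x} → x ∈ digits β →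
                      ∃ λ i → i ∈ B × x ∈ digits (lookup σs i)
  interlacing-digit k (same-digits , _) x∈ with Equivalence.to (same-digits _) x∈
  ... | τ , τ∈ , x∈τ with ∈-map⁻ (lookup σs) τ∈
  ... | i , i∈ , refl = i , i∈ , x∈τ

  interlacings-disjoint : ∀ k blocks βs → Pointwise (Interlaces k) blocks βs →
                          Unique (concat blocks) → AllPairs (Disjoint on digits) βs
  interlacings-disjoint k [] [] [] _ = []
  interlacings-disjoint k (B ∷ Bs) (β ∷ βs) (r ∷ rs) u =
    All.tabulate apart ∷ interlacings-disjoint k Bs βs rs (unique-++⇒unique-right B u)
    where
    apart : ∀ {β′} → β′ ∈ βs → Disjoint (digits β) (digits β′)
    apart {β′} β′∈ {x} (x∈β , x∈β′) with pointwise-∈ʳ rs β′∈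
    ... | B′ , B′∈ , r′ with interlacing-digit k {B} {β} r x∈β | interlacing-digit k {B′} {β′} r′ x∈β′
    ... | i , i∈B , x∈i | i′ , i′∈B′ , x∈i′ with σs-disjoint i i′ x x∈i x∈i′
    ... | refl = unique-++⇒disjoint B u (i∈B , ∈-concat⁺′ i′∈B′ B′∈)

  -- Backward direction: α agrees with the interlacing β of the block of x on the digits of β,
  -- a set closed under β, so αᵏ x = βᵏ x, which is σ x.
  factorisation⇒root : ∀ k {α} → InterlacingFactorisation k α → (α ^ₚ k) ≐ σ
  factorisation⇒root k {α} (blocks , (_ , blocks↭) , βs , interlace , α≐) x with σs-cover x
  ... | i , x∈i with ∈-concat⁻′ blocks (∈-resp-↭ (↭-sym blocks↭) (∈-allFin i))
  ... | B , i∈B , B∈ with pointwise-∈ˡ interlace B∈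
  ... | β , β∈ , (same-digits , β^k) = begin
    (α ^ₚ k) x                    ≡⟨ sym (pow-agree ⟦ β ⟧ α (digits β) β-agrees closed k x x∈β) ⟩
    (⟦ β ⟧ ^ₚ k) x                ≡⟨ β^k x ⟩
    prodPC (map (lookup σs) B) x  ≡⟨ prodPC-on _ (selection-non-overlapping B) (∈-map⁺ (lookup σs) i∈B) x x∈i ⟩
    ⟦ lookup σs i ⟧ x             ≡⟨ sym (σ-on (∈-lookup i) x x∈i) ⟩
    σ x                           ∎
    where
    open ≡-Reasoning
    x∈β : x ∈ digits β
    x∈β = Equivalence.from (same-digits x) (lookup σs i , ∈-map⁺ (lookup σs) i∈B , x∈i)
    βs-apart : AllPairs (Disjoint on digits) βs
    βs-apart = interlacings-disjoint k blocks βs interlace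
                 (Unique-resp-↭ (setoid (Fin n)) (↭⇒↭ₛ (↭-sym blocks↭)) (Unique.allFin⁺ n))
    β-agrees : ∀ z → z ∈ digits β → ⟦ β ⟧ z ≡ α z
    β-agrees z z∈ = sym (trans (α≐ z) (prodPC-on βs (pairwise-disjoint⇒non-overlapping βs-apart) β∈ z z∈))
    closed : ∀ z w → z ∈ digits β → ⟦ β ⟧ z ≡ just w → w ∈ digits β
    closed z _ _ z↦w = pc-codomain β z z↦w

  module RootStructure (k : ℕ) {α γs} (D : PCDecomposition α γs) (root : (α ^ₚ suc k) ≐ σ) where
    open PCDecomposition D

    closed : ∀ (γ : PC N) z w → z ∈ digits γ → ⟦ γ ⟧ z ≡ just w → w ∈ digits γ
    closed γ z _ _ z↦w = pc-codomain γ z z↦w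

    component-power : ∀ {γ} → γ ∈ γs → ∀ j x → x ∈ digits γ → (⟦ γ ⟧ ^ₚ j) x ≡ (α ^ₚ j) x
    component-power {γ} γ∈ = pow-agree ⟦ γ ⟧ α (digits γ) (agrees γ∈) (closed γ)

    -- A σ-step never leaves a component, as σ = α^(k+1) ...
    σ-stays : ∀ {γ} → γ ∈ γs → ∀ {a b} → σ a ≡ just b → a ∈ digits γ → b ∈ digits γ
    σ-stays {γ} γ∈ {a} {b} a↦b a∈ =
      pow-closed ⟦ γ ⟧ (digits γ) (closed γ) (suc k) a b a∈
        (trans (component-power γ∈ (suc k) a a∈) (trans (root a) a↦b))

    -- ... nor enters one, since the components partition X.
    σ-step-invariant : ∀ {γ} → γ ∈ γs → ∀ {a b} → σ a ≡ just b → a ∈ digits γ ⇔ b ∈ digits γ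
    σ-step-invariant {γ} γ∈ {a} {b} a↦b = mk⇔ (σ-stays γ∈ a↦b) enters
      where
      enters : b ∈ digits γ → a ∈ digits γ
      enters b∈ with covers a
      ... | γ′ , γ′∈ , a∈′ =
        subst (λ g → a ∈ digits g)
          (pairwise-disjoint⇒non-overlapping disjoint γ′∈ γ∈ (σ-stays γ′∈ a↦b a∈′) b∈) a∈′

    -- Hence each factor σᵢ, whose digits form a σ-chain, lies entirely in one component.
    factor-inside : ∀ i {γ} → γ ∈ γs → ∀ {x y} → x ∈ digits (lookup σs i) → y ∈ digits (lookup σs i) →
                    x ∈ digits γ → y ∈ digits γ
    factor-inside i {γ} γ∈ x∈ y∈ x∈γ = All.lookup (linked-spread invariant (pc-linked τ) (lose x∈ x∈γ)) y∈
      where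
      τ : PC N
      τ = lookup σs i
      invariant : ∀ {u v} → ⟦ τ ⟧ u ≡ just v → u ∈ digits γ ⇔ v ∈ digits γ
      invariant {u} u↦v = σ-step-invariant γ∈ (trans (σ-on (∈-lookup i) u (pc-domain τ u u↦v)) u↦v)

    InBlock : PC N → Fin n → Set
    InBlock γ i = PC.first (lookup σs i) ∈ digits γ

    in-block? : ∀ γ → Decidable (InBlock γ)
    in-block? γ i = PC.first (lookup σs i) ∈? digits γ

    block : PC N → List (Fin n)
    block γ = filter (in-block? γ) (allFin n)

    digit-in-block : ∀ {γ} → γ ∈ γs → ∀ x → x ∈ digits γ → ∃ λ i → i ∈ block γ × x ∈ digits (lookup σs i)
    digit-in-block {γ} γ∈ x x∈ with σs-cover x
    ... | i , x∈i = i , ∈-filter⁺ (in-block? γ) (∈-allFin i) (factor-inside i γ∈ x∈i (here refl) x∈) , x∈i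

    -- The blocks form a set partition: each factor's first digit lies in exactly one component.
    block-partition : IsSetPartition n (map block γs)
    block-partition =
      AllP.map⁺ (All.tabulate (λ γ∈ → nonempty γ∈)) ,
      filterAll-↭ InBlock in-block? (allFin n) γs
        (λ i _ → component-of (PC.first (lookup σs i)) , AllPairs.map (λ apart both → apart both) disjoint)
      where
      nonempty : ∀ {γ} → γ ∈ γs → NonEmpty (block γ)
      nonempty {γ} γ∈ with digit-in-block γ∈ (PC.first γ) (here refl)
      ... | _ , i∈ , _ = ∈⇒NonEmpty i∈
      component-of : ∀ x → Any (λ γ → x ∈ digits γ) γs
      component-of x with covers x
      ... | _ , γ∈ , x∈ = lose γ∈ x∈

    component-interlaces : ∀ {γ} → γ ∈ γs → Interlaces (suc k) (block γ) γ
    component-interlaces {γ} γ∈ = (λ x → mk⇔ (to x) (from x)) , power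
      where
      factors : List (PC N)
      factors = map (lookup σs) (block γ)
      to : ∀ x → x ∈ digits γ → ∃ λ τ → τ ∈ factors × x ∈ digits τ
      to x x∈ with digit-in-block γ∈ x x∈
      ... | i , i∈ , x∈i = lookup σs i , ∈-map⁺ (lookup σs) i∈ , x∈i
      from : ∀ x → (∃ λ τ → τ ∈ factors × x ∈ digits τ) → x ∈ digits γ
      from x (τ , τ∈ , x∈τ) with ∈-map⁻ (lookup σs) τ∈
      ... | i , i∈ , refl = factor-inside i γ∈ (here refl) x∈τ (proj₂ (∈-filter⁻ (in-block? γ) {xs = allFin n} i∈))
      power : (⟦ γ ⟧ ^ₚ suc k) ≐ prodPC factors
      power x with x ∈? digits γ
      ... | no x∉ = trans (pow-undefined ⟦ γ ⟧ k x (pc-outside γ x x∉))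
                          (sym (prodPC-off factors x (λ τ τ∈ x∈τ → x∉ (from x (τ , τ∈ , x∈τ)))))
      ... | yes x∈ with digit-in-block γ∈ x x∈
      ... | i , i∈ , x∈i = begin
        (⟦ γ ⟧ ^ₚ suc k) x  ≡⟨ component-power γ∈ (suc k) x x∈ ⟩
        (α ^ₚ suc k) x      ≡⟨ root x ⟩
        σ x                 ≡⟨ σ-on (∈-lookup i) x x∈i ⟩
        ⟦ lookup σs i ⟧ x   ≡⟨ sym (prodPC-on factors (selection-non-overlapping (block γ))
                                            (∈-map⁺ (lookup σs) i∈) x x∈i) ⟩
        prodPC factors x    ∎
        where open ≡-Reasoning

    factorisation : InterlacingFactorisation (suc k) α
    factorisation = map block γs , block-partition , γs ,
                    pointwise-image block γs (λ _ γ∈ → component-interlaces γ∈) , PCDecomposition-product D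

  root⇒factorisation : ∀ k {α} → IsPartialInjective α → (α ^ₚ suc k) ≐ σ → InterlacingFactorisation (suc k) α
  root⇒factorisation k {α} α-inj root = RootStructure.factorisation k (proj₂ (decompose α α-inj)) root

theorem1 : (k : ℕ) → 1 ≤ k → (N : ℕ) → (σ : PMap N) → IsPartialInjective σ →
    (σs : List (PC N)) → IsDecomposition σ σs →
    (α : PMap N) → IsPartialInjective α →
    ((α ^ₚ k) ≐ σ) ⇔
      (Σ (List (List (Fin (length σs)))) λ blocks → IsSetPartition (length σs) blocks ×
        (Σ (List (PC N)) λ βs →
          Pointwise (λ B β → IsInterlacing k (map (lookup σs) B) β) blocks βs ×
          (α ≐ prodPC βs)))
theorem1 (suc k) (s≤s z≤n) N σ _ σs dec α α-inj =
  mk⇔ (root⇒factorisation dec k α-inj) (factorisation⇒root dec (suc k))
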